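{- Let $G=(V,E)$ be a digraph with vertices $v_1,\dots,v_n$, and let $G'$ be the digraph constructed from $G$ as follows: if $G$ is Eulerian, $G'=G$; otherwise $G'$ is obtained from a copy of $G$ by adding a new vertex $s$, and, for each $i$ with $\mathrm{indeg}_G(v_i)<\mathrm{outdeg}_G(v_i)$, adding $p_i=\mathrm{outdeg}_G(v_i)-\mathrm{indeg}_G(v_i)$ new vertices $w_{i,1},\dots,w_{i,p_i}$ and arcs $(s,w_{i,j})$, $(w_{i,j},v_i)$ for $1\le j\le p_i$; and for each $i$ with $\mathrm{outdeg}_G(v_i)<\mathrm{indeg}_G(v_i)$, adding $q_i=\mathrm{indeg}_G(v_i)-\mathrm{outdeg}_G(v_i)$ new vertices $w_{i,1},\dots,w_{i,q_i}$ and arcs $(w_{i,j},s)$, $(v_i,w_{i,j})$ for $1\le j\le q_i$. Let $r$ be the maximum number of arcs of an acyclic arc set of $G$ and $d=\sum_{i:\ \mathrm{indeg}_G(v_i)<\mathrm{outdeg}_G(v_i)}(\mathrm{outdeg}_G(v_i)-\mathrm{indeg}_G(v_i))$. Then the maximum number of arcs of an acyclic arc set of $G'$ is $3d+r$.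
   Context: Digraphs are finite, simple and connected. A digraph is Eulerian if every vertex has in-degree equal to out-degree. An acyclic arc set of a digraph $H$ is a subset of its arcs forming, together with all vertices of $H$, a digraph with no directed cycle. -}

module Defs where

open import Data.Nat using (ℕ; zero; suc; _+_; _*_; _≤_; _<ᵇ_; ∣_-_∣; _≟_)
open import Data.Nat.Properties using (_<?_)
open import Data.Fin using (Fin)
open import Data.Fin.Properties using (all?) renaming (_≟_ to _≟ᶠ_)
open import Data.Bool using (if_then_else_)
open import Data.List using (List; []; _∷_; length; filter; map; concatMap; allFin)
open import Data.Nat.ListAction using (sum)
open import Data.List.Membership.Propositional using (_∈_)
open import Data.List.Relation.Unary.Unique.Propositional using (Unique)
open import Data.Product using (_×_; _,_; proj₁; proj₂; ∃-syntax; Σ)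
open import Data.Sum using (_⊎_; inj₁; inj₂)
open import Data.Unit using (⊤; tt)
open import Relation.Binary.PropositionalEquality using (_≡_; _≢_)
open import Relation.Nullary using (¬_; Dec; yes; no)

record Digraph : Set₁ where
  constructor digraph
  field
    V    : Set
    arcs : List (V × V)
open Digraph public

data Path {V : Set} (A : List (V × V)) : V → V → Set where
  one  : ∀ {u v}   → (u , v) ∈ A → Path A u v
  cons : ∀ {u w v} → (u , w) ∈ A → Path A w v → Path A u v

data WConn {V : Set} (A : List (V × V)) : V → V → Set where
  here : ∀ {u} → WConn A u u
  fwd  : ∀ {u w v} → (u , w) ∈ A → WConn A w v → WConn A u v
  bwd  : ∀ {u w v} → (w , u) ∈ A → WConn A w v → WConn A u v

Simple : Digraph → Set
Simple D = Unique (arcs D) × (∀ {u v} → (u , v) ∈ arcs D → u ≢ v)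

Connected : Digraph → Set
Connected D = ∀ (u v : V D) → WConn (arcs D) u v

IsAcyclicArcSet : (D : Digraph) → List (V D × V D) → Set
IsAcyclicArcSet D A =
  Unique A × (∀ {a} → a ∈ A → a ∈ arcs D) × (∀ v → ¬ Path A v v)

IsMaxAcyclic : Digraph → ℕ → Set
IsMaxAcyclic D m =
  (∃[ A ] (IsAcyclicArcSet D A × length A ≡ m))
  × (∀ A → IsAcyclicArcSet D A → length A ≤ m)

-- Digraphs on vertices Fin n (v_i = i).

module _ {n : ℕ} (E : List (Fin n × Fin n)) where

  indeg : Fin n → ℕ
  indeg v = length (filter (λ a → proj₂ a ≟ᶠ v) E)

  outdeg : Fin n → ℕ
  outdeg v = length (filter (λ a → proj₁ a ≟ᶠ v) E)

  Eulerian : Set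
  Eulerian = ∀ v → indeg v ≡ outdeg v

  eulerian? : Dec Eulerian
  eulerian? = all? (λ v → indeg v ≟ outdeg v)

  dval : ℕ
  dval = sum (map (λ i → ∣ outdeg i - indeg i ∣)
                  (filter (λ i → indeg i <? outdeg i) (allFin n)))

  -- number of new vertices w_{i,j} attached to v_i (p_i, q_i, or 0)
  gap : Fin n → ℕ
  gap i = ∣ outdeg i - indeg i ∣

  -- vertex set of the extended digraph: copy of G, the vertex s, the w_{i,j}
  V' : Set
  V' = Fin n ⊎ (⊤ ⊎ Σ (Fin n) (λ i → Fin (gap i)))

  vtx : Fin n → V'
  vtx = inj₁

  s : V'
  s = inj₂ (inj₁ tt)

  w : (i : Fin n) → Fin (gap i) → V'
  w i j = inj₂ (inj₂ (i , j))

  newArcs : (i : Fin n) → Fin (gap i) → List (V' × V')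
  newArcs i j =
    if indeg i <ᵇ outdeg i then (s , w i j) ∷ (w i j , vtx i) ∷ []
    else if outdeg i <ᵇ indeg i then (w i j , s) ∷ (vtx i , w i j) ∷ []
    else []

  extended : Digraph
  extended = digraph V'
    (map (λ a → (vtx (proj₁ a) , vtx (proj₂ a))) E
      Data.List.++ concatMap (λ i → concatMap (newArcs i) (allFin (gap i))) (allFin n))

  G : Digraph
  G = digraph (Fin n) E

  G' : Digraph
  G' with eulerian?
  ... | yes _ = G
  ... | no  _ = extended

module Submission where

-- Write pᵢ = outdeg − indeg at a surplus vertex (indeg < outdeg) and qᵢ = indeg − outdeg
-- at a deficit vertex, so d = Σ pᵢ; the handshake identity Σ outdeg = Σ indeg gives Σ qᵢ = d.
-- If G is Eulerian then d = 0 and G' = G.  Otherwise G' is the extended digraph, and: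
--  * lower bound: an acyclic arc set of G, plus both arcs s → w → vᵢ of every surplus gadget
--    and the arc vᵢ → w of every deficit gadget, is acyclic, since these arcs climb the
--    layers s < w(surplus) < copy of G < w(deficit); it has 2d + d = 3d new arcs;
--  * upper bound: given an acyclic A' in G', let L be the set of vᵢ reaching s in A'.  A' uses
--    one arc only of a surplus gadget at vᵢ ∈ L and of a deficit gadget at vᵢ ∉ L, and no arc of
--    G entering L.  Its arcs of G inside L or inside the complement, together with all arcs of G
--    entering L, form an acyclic arc set B of G, and the cut identity
--    Σ_{i∈L} outdeg + e(L̄,L) = Σ_{i∈L} indeg + e(L,L̄) shows |A'| ≤ 3d + |B|.  The count is
--    an injection of A' (redirecting the unusable gadget arcs) into an explicit list.

open import Defs
open import Data.Nat using (ℕ; zero; suc; _+_; _*_; _≤_; _<_; _<ᵇ_; z≤n; s≤s)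
open import Data.Nat.Properties
  using ( +-identityʳ; +-comm; *-comm; *-identityʳ; *-zeroʳ; *-distribˡ-+; +-mono-≤; +-monoʳ-≤
        ; +-cancelˡ-≡; +-cancelˡ-≤; ≤-reflexive; ≤-trans; ≤-antisym; ≮⇒≥; <⇒≤; <-trans; <-irrefl; <-asym
        ; <ᵇ⇒<; <⇒<ᵇ; _<?_; m∸n+n≡m; m≤n⇒∣n-m∣≡n∸m; m≤n⇒∣m-n∣≡n∸m; m≡n⇒∣m-n∣≡0; module ≤-Reasoning)
open import Data.Nat.Tactic.RingSolver using (solve-∀)
open import Data.Nat.ListAction using (sum)
open import Data.Bool using (Bool; true; false; T; if_then_else_)
import Data.Bool.Properties as Bool
open import Data.Fin using (Fin; _≟_) renaming (zero to fzero; suc to fsuc)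
open import Data.List using (List; []; _∷_; _++_; length; filter; map; concatMap; allFin; tabulate)
open import Data.List.Properties using (length-++; length-map)
open import Data.List.Membership.Propositional using (_∈_; find; lose)
open import Data.List.Membership.Propositional.Properties
  using (∈-++⁺ˡ; ∈-++⁺ʳ; ∈-++⁻; ∈-map⁺; ∈-map⁻; ∈-allFin; ∈-filter⁺; ∈-filter⁻; ∈-concatMap⁺; ∈-concatMap⁻)
open import Data.List.Relation.Unary.Any using (here; there)
open import Data.List.Relation.Unary.All as All using ([]; _∷_)
open import Data.List.Relation.Unary.AllPairs using ([]; _∷_)
open import Data.List.Relation.Unary.Unique.Propositional using (Unique)
import Data.List.Relation.Unary.Unique.Propositional.Properties as Unique
open import Data.Maybe using (Maybe; just; nothing; _<∣>_)
import Data.Maybe as Maybe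
open import Data.Product using (_×_; _,_; proj₁; proj₂; Σ; ∃; ∃₂)
import Data.Product.Properties as Σ
open import Data.Sum using (_⊎_; inj₁; inj₂; [_,_]′)
import Data.Sum.Properties as ⊎
import Data.Unit.Properties as Unit
open import Data.Empty using (⊥-elim)
open import Function using (_∘_)
open import Relation.Binary.Definitions using (DecidableEquality)
open import Relation.Binary.Construct.Closure.ReflexiveTransitive as Star using (Star; ε; _◅_; _◅◅_)
open import Relation.Binary.PropositionalEquality hiding ([_])
open import Relation.Nullary using (¬_; Dec; yes; no; does)
open import Relation.Nullary.Decidable using (_×-dec_; dec-true; dec-false)
open import Relation.Unary using (Pred; Decidable)

pick : Bool → ℕ → ℕ
pick true  x = x
pick false x = 0

[_] : Bool → ℕ
[ b ] = pick b 1

pick-+ : ∀ b x y → pick b (x + y) ≡ pick b x + pick b y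
pick-+ true  x y = refl
pick-+ false x y = refl

pick-0 : ∀ b → pick b 0 ≡ 0
pick-0 true  = refl
pick-0 false = refl

∑ : {A : Set} → List A → (A → ℕ) → ℕ
∑ []       f = 0
∑ (x ∷ xs) f = f x + ∑ xs f

module _ {A : Set} where

  ∑-+ : ∀ (xs : List A) f g → ∑ xs f + ∑ xs g ≡ ∑ xs (λ x → f x + g x)
  ∑-+ []       f g = refl
  ∑-+ (x ∷ xs) f g = trans (shuffle (f x) (∑ xs f) (g x) (∑ xs g))
                           (cong (f x + g x +_) (∑-+ xs f g))
    where
    shuffle : ∀ a b c e → (a + b) + (c + e) ≡ (a + c) + (b + e)
    shuffle = solve-∀

  ∑-cong : ∀ (xs : List A) {f g} → (∀ x → f x ≡ g x) → ∑ xs f ≡ ∑ xs g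
  ∑-cong []       f≡g = refl
  ∑-cong (x ∷ xs) f≡g = cong₂ _+_ (f≡g x) (∑-cong xs f≡g)

  ∑-mono : ∀ (xs : List A) {f g} → (∀ x → f x ≤ g x) → ∑ xs f ≤ ∑ xs g
  ∑-mono []       f≤g = z≤n
  ∑-mono (x ∷ xs) f≤g = +-mono-≤ (f≤g x) (∑-mono xs f≤g)

  ∑-zero : ∀ (xs : List A) {f} → (∀ x → f x ≡ 0) → ∑ xs f ≡ 0
  ∑-zero []       f≡0 = refl
  ∑-zero (x ∷ xs) f≡0 = cong₂ _+_ (f≡0 x) (∑-zero xs f≡0)

  ∑-*ˡ : ∀ (xs : List A) c f → c * ∑ xs f ≡ ∑ xs (λ x → c * f x)
  ∑-*ˡ []       c f = *-zeroʳ c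
  ∑-*ˡ (x ∷ xs) c f = trans (*-distribˡ-+ c (f x) _) (cong (c * f x +_) (∑-*ˡ xs c f))

  length-concatMap : ∀ {B : Set} (f : A → List B) xs →
                     length (concatMap f xs) ≡ ∑ xs (λ x → length (f x))
  length-concatMap f []       = refl
  length-concatMap f (x ∷ xs) = trans (length-++ (f x)) (cong (length (f x) +_) (length-concatMap f xs))

  length-filter : ∀ {p} {P : Pred A p} (P? : Decidable P) xs →
                  length (filter P? xs) ≡ ∑ xs (λ x → [ does (P? x) ])
  length-filter P? []       = refl
  length-filter P? (x ∷ xs) with does (P? x)
  ... | true  = cong suc (length-filter P? xs)
  ... | false = length-filter P? xs

  sum-filter : ∀ {p} {P : Pred A p} (P? : Decidable P) f xs →
               sum (map f (filter P? xs)) ≡ ∑ xs (λ x → pick (does (P? x)) (f x))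
  sum-filter P? f []       = refl
  sum-filter P? f (x ∷ xs) with does (P? x)
  ... | true  = cong (f x +_) (sum-filter P? f xs)
  ... | false = sum-filter P? f xs

∑-tabulate : ∀ {A : Set} {n} (g : Fin n → A) (f : A → ℕ) →
             ∑ (tabulate g) f ≡ ∑ (allFin n) (λ i → f (g i))
∑-tabulate {n = zero}  g f = refl
∑-tabulate {n = suc n} g f =
  cong (f (g fzero) +_) (trans (∑-tabulate (λ i → g (fsuc i)) f) (sym (∑-tabulate fsuc (λ i → f (g i)))))

∑-const : ∀ n c → ∑ (allFin n) (λ _ → c) ≡ n * c
∑-const zero    c = refl
∑-const (suc n) c = cong (c +_) (trans (∑-tabulate {n = n} fsuc (λ _ → c)) (∑-const n c))

∑-point : ∀ {n} (x : Fin n) (f : Fin n → ℕ) → (∀ i → x ≢ i → f i ≡ 0) → ∑ (allFin n) f ≡ f x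
∑-point {suc n} fzero f zero-off =
  trans (cong (f fzero +_) (trans (∑-tabulate fsuc f) (∑-zero (allFin n) (λ i → zero-off (fsuc i) (λ ())))))
        (+-identityʳ _)
∑-point {suc n} (fsuc x) f zero-off =
  trans (cong₂ _+_ (zero-off fzero (λ ())) (∑-tabulate fsuc f))
        (∑-point x (λ i → f (fsuc i)) (λ i x≢i → zero-off (fsuc i) (λ { refl → x≢i refl })))

module _ {X : Set} where

  remove : ∀ {x : X} {ys} → x ∈ ys → List X
  remove {ys = y ∷ ys} (here _)  = ys
  remove {ys = y ∷ ys} (there p) = y ∷ remove p

  length-remove : ∀ {x : X} {ys} (p : x ∈ ys) → suc (length (remove p)) ≡ length ys
  length-remove (here _)  = refl
  length-remove (there p) = cong suc (length-remove p)

  ∈-remove : ∀ {x y : X} {ys} (p : x ∈ ys) → y ∈ ys → x ≢ y → y ∈ remove p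
  ∈-remove (here refl) (here refl) x≢y = ⊥-elim (x≢y refl)
  ∈-remove (here _)    (there q)   x≢y = q
  ∈-remove (there p)   (here refl) x≢y = here refl
  ∈-remove (there p)   (there q)   x≢y = there (∈-remove p q x≢y)

  unique-length-≤ : ∀ (xs ys : List X) → Unique xs → (∀ {z} → z ∈ xs → z ∈ ys) → length xs ≤ length ys
  unique-length-≤ []       ys u        xs⊆ys = z≤n
  unique-length-≤ (x ∷ xs) ys (x∉ ∷ u) xs⊆ys =
    subst (suc (length xs) ≤_) (length-remove x∈ys)
      (s≤s (unique-length-≤ xs (remove x∈ys) u (λ z∈ → ∈-remove x∈ys (xs⊆ys (there z∈)) (All.lookup x∉ z∈))))
    where
    x∈ys : x ∈ ys
    x∈ys = xs⊆ys (here refl)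

module _ {A B : Set} where

  map-unique : ∀ (f : A → B) {xs} → Unique xs →
               (∀ {a b} → a ∈ xs → b ∈ xs → f a ≡ f b → a ≡ b) → Unique (map f xs)
  map-unique f {[]}     u        inj = []
  map-unique f {x ∷ xs} (x∉ ∷ u) inj =
    All.tabulate fx∉ ∷ map-unique f u (λ a∈ b∈ → inj (there a∈) (there b∈))
    where
    fx∉ : ∀ {y} → y ∈ map f xs → f x ≢ y
    fx∉ y∈ fx≡y with ∈-map⁻ f y∈
    ... | b , b∈ , refl = All.lookup x∉ b∈ (inj (here refl) (there b∈) fx≡y)

  injection-length-≤ : ∀ (f : A → B) xs ys → Unique xs →
    (∀ {a b} → a ∈ xs → b ∈ xs → f a ≡ f b → a ≡ b) → (∀ {a} → a ∈ xs → f a ∈ ys) →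
    length xs ≤ length ys
  injection-length-≤ f xs ys u inj into = begin
    length xs         ≡⟨ sym (length-map f xs) ⟩
    length (map f xs) ≤⟨ unique-length-≤ (map f xs) ys (map-unique f u inj) image⊆ys ⟩
    length ys         ∎
    where
    open ≤-Reasoning
    image⊆ys : ∀ {z} → z ∈ map f xs → z ∈ ys
    image⊆ys z∈ with ∈-map⁻ f z∈
    ... | a , a∈ , refl = into a∈

  ∈-concatMap-∃ : ∀ (f : A → List B) {xs b} → b ∈ concatMap f xs → ∃ λ x → x ∈ xs × b ∈ f x
  ∈-concatMap-∃ f b∈ = find (∈-concatMap⁻ f b∈)

  ∈-concatMap-intro : ∀ (f : A → List B) {xs x b} → x ∈ xs → b ∈ f x → b ∈ concatMap f xs
  ∈-concatMap-intro f x∈ b∈ = ∈-concatMap⁺ f (lose x∈ b∈)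

  concatMap-unique : ∀ {K : Set} (f : A → List B) (key : B → K) (tag : A → K) →
    (∀ {x y} → tag x ≡ tag y → x ≡ y) → (∀ {x b} → b ∈ f x → key b ≡ tag x) →
    (∀ x → Unique (f x)) → ∀ {xs} → Unique xs → Unique (concatMap f xs)
  concatMap-unique f key tag tag-inj keyed uf {[]}     u        = []
  concatMap-unique f key tag tag-inj keyed uf {x ∷ xs} (x∉ ∷ u) =
    Unique.++⁺ (uf x) (concatMap-unique f key tag tag-inj keyed uf u) disjoint
    where
    disjoint : ∀ {b} → ¬ (b ∈ f x × b ∈ concatMap f xs)
    disjoint (b∈fx , b∈rest) with ∈-concatMap-∃ f b∈rest
    ... | y , y∈ , b∈fy = All.lookup x∉ y∈ (tag-inj (trans (sym (keyed b∈fx)) (keyed b∈fy)))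

does-true : ∀ {P : Set} (P? : Dec P) → does P? ≡ true → P
does-true (yes p) _ = p

does-false : ∀ {P : Set} (P? : Dec P) → does P? ≡ false → ¬ P
does-false (no ¬p) _ = ¬p

module _ {V : Set} where

  Arc : List (V × V) → V → V → Set
  Arc A u v = (u , v) ∈ A

  arc◅star⇒path : ∀ {A u w v} → (u , w) ∈ A → Star (Arc A) w v → Path A u v
  arc◅star⇒path m ε          = one m
  arc◅star⇒path m (m' ◅ st) = cons m (arc◅star⇒path m' st)

  star-split : ∀ {x y : V} {A u v} → Star (Arc ((x , y) ∷ A)) u v →
               Star (Arc A) u v ⊎ (Star (Arc A) u x × Star (Arc A) y v)
  star-split ε = inj₁ ε
  star-split (here refl ◅ st) with star-split st
  ... | inj₁ st'           = inj₂ (ε , st')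
  ... | inj₂ (_ , y⇝v)     = inj₂ (ε , y⇝v)
  star-split (there m ◅ st) with star-split st
  ... | inj₁ st'           = inj₁ (m ◅ st')
  ... | inj₂ (w⇝x , y⇝v)   = inj₂ (m ◅ w⇝x , y⇝v)

  reachable? : DecidableEquality V → (A : List (V × V)) → (u v : V) → Dec (Star (Arc A) u v)
  reachable? _≟V_ [] u v with u ≟V v
  ... | yes refl = yes ε
  ... | no u≢v   = no λ { ε → u≢v refl ; (() ◅ _) }
  reachable? _≟V_ ((x , y) ∷ A) u v
    with reachable? _≟V_ A u v | reachable? _≟V_ A u x | reachable? _≟V_ A y v
  ... | yes u⇝v | _       | _       = yes (Star.map there u⇝v)
  ... | no _    | yes u⇝x | yes y⇝v = yes (Star.map there u⇝x ◅◅ (here refl ◅ Star.map there y⇝v))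
  ... | no u↛v  | no u↛x  | _       = no λ st → [ u↛v , u↛x ∘ proj₁ ]′ (star-split st)
  ... | no u↛v  | _       | no y↛v  = no λ st → [ u↛v , y↛v ∘ proj₂ ]′ (star-split st)

  path-rank : ∀ (rank : V → ℕ) {B C : List (V × V)} →
    (∀ {x y} → (x , y) ∈ B → rank x ≡ rank y) → (∀ {x y} → (x , y) ∈ C → rank x < rank y) →
    ∀ {x y} → Path (B ++ C) x y → rank x < rank y ⊎ Path B x y
  path-rank rank {B} flat up (one m) with ∈-++⁻ B m
  ... | inj₁ m∈B = inj₂ (one m∈B)
  ... | inj₂ m∈C = inj₁ (up m∈C)
  path-rank rank {B} flat up {x} {y} (cons m p) with ∈-++⁻ B m | path-rank rank flat up p
  ... | inj₁ m∈B | inj₂ q   = inj₂ (cons m∈B q)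
  ... | inj₁ m∈B | inj₁ lt  = inj₁ (subst (_< rank y) (sym (flat m∈B)) lt)
  ... | inj₂ m∈C | inj₁ lt  = inj₁ (<-trans (up m∈C) lt)
  ... | inj₂ m∈C | inj₂ q   = inj₁ (subst (rank x <_) (path-flat q) (up m∈C))
    where
    path-flat : ∀ {u v} → Path B u v → rank u ≡ rank v
    path-flat (one m)    = flat m
    path-flat (cons m q) = trans (flat m) (path-flat q)

path-unmap : ∀ {U V : Set} (f : U → V) → (∀ {u u'} → f u ≡ f u' → u ≡ u') →
  ∀ {A : List (U × U)} {u v} → Path (map (λ a → f (proj₁ a) , f (proj₂ a)) A) (f u) (f v) → Path A u v
path-unmap {U} f f-inj {A} p = go p refl refl
  where
  arc-unmap : ∀ {x y u} → (x , y) ∈ map (λ a → f (proj₁ a) , f (proj₂ a)) A → x ≡ f u →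
              ∃ λ u' → (u , u') ∈ A × y ≡ f u'
  arc-unmap m x≡fu with ∈-map⁻ _ m
  ... | (a₁ , a₂) , a∈ , refl = a₂ , subst (λ t → (t , a₂) ∈ A) (f-inj x≡fu) a∈ , refl
  go : ∀ {x y u v} → Path (map (λ a → f (proj₁ a) , f (proj₂ a)) A) x y → x ≡ f u → y ≡ f v → Path A u v
  go (one m) x≡fu y≡fv with arc-unmap m x≡fu
  ... | u' , a∈ , refl = one (subst (λ t → (_ , t) ∈ A) (f-inj y≡fv) a∈)
  go (cons m p) x≡fu y≡fv with arc-unmap m x≡fu
  ... | u' , a∈ , refl = cons a∈ (go p refl y≡fv)

∑-incidences : ∀ {n} {X : Set} (end : X → Fin n) (p : Fin n → Bool) (xs : List X) →
  ∑ (allFin n) (λ i → pick (p i) (∑ xs (λ a → [ does (end a ≟ i) ]))) ≡ ∑ xs (λ a → [ p (end a) ])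
∑-incidences {n} end p [] = ∑-zero (allFin n) (λ i → pick-0 (p i))
∑-incidences {n} end p (a ∷ xs) = begin
  ∑ (allFin n) (λ i → pick (p i) ([ does (end a ≟ i) ] + rest i))
    ≡⟨ ∑-cong (allFin n) (λ i → pick-+ (p i) _ (rest i)) ⟩
  ∑ (allFin n) (λ i → pick (p i) [ does (end a ≟ i) ] + pick (p i) (rest i))
    ≡⟨ sym (∑-+ (allFin n) _ _) ⟩
  ∑ (allFin n) (λ i → pick (p i) [ does (end a ≟ i) ]) + ∑ (allFin n) (λ i → pick (p i) (rest i))
    ≡⟨ cong₂ _+_ (∑-point (end a) _ off-end) (∑-incidences end p xs) ⟩
  pick (p (end a)) [ does (end a ≟ end a) ] + ∑ xs (λ a → [ p (end a) ])
    ≡⟨ cong (λ b → pick (p (end a)) [ b ] + _) (dec-true (end a ≟ end a) refl) ⟩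
  [ p (end a) ] + ∑ xs (λ a → [ p (end a) ]) ∎
  where
  open ≡-Reasoning
  rest : Fin n → ℕ
  rest i = ∑ xs (λ a → [ does (end a ≟ i) ])
  off-end : ∀ i → end a ≢ i → pick (p i) [ does (end a ≟ i) ] ≡ 0
  off-end i ≢i = trans (cong (λ b → pick (p i) [ b ]) (dec-false (end a ≟ i) ≢i)) (pick-0 (p i))

false≢true : false ≢ true
false≢true ()

-- The three possible balances of a vertex with out-degree x, in-degree y and
-- gap g = |x − y|, indexed by the two strict comparisons b⁺ = (y < x), b⁻ = (x < y).
data Balance : Bool → Bool → ℕ → ℕ → ℕ → Set where
  surplus  : ∀ g y → Balance true false g (g + y) y
  deficit  : ∀ g x → Balance false true g x (g + x)
  balanced : ∀ x → Balance false false 0 x x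

-- The number of arcs of `gadget b⁺ b⁻ reach i j` (defined below).
gadget-size : Bool → Bool → Bool → ℕ
gadget-size true  _     true  = 1
gadget-size true  _     false = 2
gadget-size false true  true  = 2
gadget-size false true  false = 1
gadget-size false false _     = 0

balance-flow : ∀ {b⁺ b⁻ g x y} → Balance b⁺ b⁻ g x y → x + pick b⁻ g ≡ y + pick b⁺ g
balance-flow (surplus g y) = trans (+-identityʳ (g + y)) (+-comm g y)
balance-flow (deficit g x) = trans (+-comm x g) (sym (+-identityʳ (g + x)))
balance-flow (balanced x)  = refl

-- What the gadgets of one vertex contribute, in the best case (reach = false):
-- 2 arcs per w-vertex at a surplus vertex, 1 per w-vertex at a deficit vertex.
gadget-exact : ∀ {b⁺ b⁻ g x y} → Balance b⁺ b⁻ g x y →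
               g * gadget-size b⁺ b⁻ false ≡ 2 * pick b⁺ g + pick b⁻ g
gadget-exact (surplus g y) = trans (*-comm g 2) (sym (+-identityʳ (2 * g)))
gadget-exact (deficit g x) = *-identityʳ g
gadget-exact (balanced x)  = refl

-- The local inequality behind the upper bound: if the vertex lies in a set L
-- (reach = true) its out-degree is charged and its in-degree credited.
gadget-bound : ∀ {b⁺ b⁻ g x y} → Balance b⁺ b⁻ g x y → ∀ reach →
  pick reach x + g * gadget-size b⁺ b⁻ reach ≤ (2 * pick b⁺ g + pick b⁻ g) + pick reach y
gadget-bound (surplus g y) true  = ≤-reflexive (eq g y)
  where
  eq : ∀ g y → (g + y) + g * 1 ≡ (2 * g + 0) + y
  eq = solve-∀
gadget-bound (surplus g y) false = ≤-reflexive (trans (gadget-exact (surplus g y)) (sym (+-identityʳ _)))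
gadget-bound (deficit g x) true  = ≤-reflexive (eq g x)
  where
  eq : ∀ g x → x + g * 2 ≡ g + (g + x)
  eq = solve-∀
gadget-bound (deficit g x) false = ≤-reflexive (trans (gadget-exact (deficit g x)) (sym (+-identityʳ _)))
gadget-bound (balanced x)  reach = ≤-reflexive (+-identityʳ (pick reach x))

module _ {b⁺ b⁻ : Bool} {g x y : ℕ} where
  surplus′ : b⁺ ≡ true → b⁻ ≡ false → g + y ≡ x → Balance b⁺ b⁻ g x y
  surplus′ refl refl refl = surplus g y

  deficit′ : b⁺ ≡ false → b⁻ ≡ true → g + x ≡ y → Balance b⁺ b⁻ g x y
  deficit′ refl refl refl = deficit g x

  balanced′ : b⁺ ≡ false → b⁻ ≡ false → g ≡ 0 → x ≡ y → Balance b⁺ b⁻ g x y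
  balanced′ refl refl refl refl = balanced x

-- Bookkeeping for the cut identity: an arc u → v counted by the side of u and by
-- whether it enters the marked set equals its count by the side of v and leaving.
crossing-count : ∀ a b → [ a ] + [ does ((a Bool.≟ false) ×-dec (b Bool.≟ true)) ]
                       ≡ [ b ] + [ does ((a Bool.≟ true) ×-dec (b Bool.≟ false)) ]
crossing-count true  true  = refl
crossing-count true  false = refl
crossing-count false true  = refl
crossing-count false false = refl

rebalance : ∀ k l e g s t D → s + e ≡ t + l → s + g ≤ D + t → (k + l) + g ≤ D + (k + e)
rebalance k l e g s t D cut bound = +-cancelˡ-≤ t _ _ (begin
  t + ((k + l) + g) ≡⟨ shuffle₁ t k l g ⟩
  (k + g) + (t + l) ≡⟨ cong ((k + g) +_) (sym cut) ⟩
  (k + g) + (s + e) ≡⟨ shuffle₂ k g s e ⟩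
  (k + e) + (s + g) ≤⟨ +-monoʳ-≤ (k + e) bound ⟩
  (k + e) + (D + t) ≡⟨ shuffle₃ k e D t ⟩
  t + (D + (k + e)) ∎)
  where
  open ≤-Reasoning
  shuffle₁ : ∀ t k l g → t + ((k + l) + g) ≡ (k + g) + (t + l)
  shuffle₁ = solve-∀
  shuffle₂ : ∀ k g s e → (k + g) + (s + e) ≡ (k + e) + (s + g)
  shuffle₂ = solve-∀
  shuffle₃ : ∀ k e D t → (k + e) + (D + t) ≡ t + (D + (k + e))
  shuffle₃ = solve-∀

module _ {n : ℕ} (E : List (Fin n × Fin n)) where

  ∑-marked : (Fin n → Bool) → (Fin n → ℕ) → ℕ
  ∑-marked p f = ∑ (allFin n) (λ i → pick (p i) (f i))

  ∑-outdeg : ∀ p → ∑-marked p (outdeg E) ≡ ∑ E (λ a → [ p (proj₁ a) ])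
  ∑-outdeg p = trans (∑-cong (allFin n) (λ i → cong (pick (p i)) (length-filter (λ a → proj₁ a ≟ i) E)))
                     (∑-incidences proj₁ p E)

  ∑-indeg : ∀ p → ∑-marked p (indeg E) ≡ ∑ E (λ a → [ p (proj₂ a) ])
  ∑-indeg p = trans (∑-cong (allFin n) (λ i → cong (pick (p i)) (length-filter (λ a → proj₂ a ≟ i) E)))
                    (∑-incidences proj₂ p E)

  handshake : ∑ (allFin n) (outdeg E) ≡ ∑ (allFin n) (indeg E)
  handshake = trans (∑-outdeg (λ _ → true)) (sym (∑-indeg (λ _ → true)))

  Leaving Entering : (Fin n → Bool) → Fin n × Fin n → Set
  Leaving  p (u , v) = p u ≡ true  × p v ≡ false
  Entering p (u , v) = p u ≡ false × p v ≡ true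

  leaving? : ∀ p → Decidable (Leaving p)
  leaving? p (u , v) = (p u Bool.≟ true) ×-dec (p v Bool.≟ false)

  entering? : ∀ p → Decidable (Entering p)
  entering? p (u , v) = (p u Bool.≟ false) ×-dec (p v Bool.≟ true)

  cut-identity : ∀ p → ∑-marked p (outdeg E) + length (filter (entering? p) E)
                     ≡ ∑-marked p (indeg E) + length (filter (leaving? p) E)
  cut-identity p = begin
    ∑-marked p (outdeg E) + length (filter (entering? p) E)
      ≡⟨ cong₂ _+_ (∑-outdeg p) (length-filter (entering? p) E) ⟩
    ∑ E (λ a → [ p (proj₁ a) ]) + ∑ E (λ a → [ does (entering? p a) ])
      ≡⟨ ∑-+ E _ _ ⟩
    ∑ E (λ a → [ p (proj₁ a) ] + [ does (entering? p a) ])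
      ≡⟨ ∑-cong E (λ (u , v) → crossing-count (p u) (p v)) ⟩
    ∑ E (λ a → [ p (proj₂ a) ] + [ does (leaving? p a) ])
      ≡⟨ sym (∑-+ E _ _) ⟩
    ∑ E (λ a → [ p (proj₂ a) ]) + ∑ E (λ a → [ does (leaving? p a) ])
      ≡⟨ sym (cong₂ _+_ (∑-indeg p) (length-filter (leaving? p) E)) ⟩
    ∑-marked p (indeg E) + length (filter (leaving? p) E) ∎
    where open ≡-Reasoning

  surplus? deficit? : Fin n → Bool
  surplus? i = indeg E i <ᵇ outdeg E i
  deficit? i = outdeg E i <ᵇ indeg E i

  balance : ∀ i → Balance (surplus? i) (deficit? i) (gap E i) (outdeg E i) (indeg E i)
  balance i with surplus? i in e⁺ | deficit? i in e⁻
  ... | true  | true  = ⊥-elim (<-asym (<ᵇ⇒< (indeg E i) _ (subst T (sym e⁺) _))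
                                      (<ᵇ⇒< (outdeg E i) _ (subst T (sym e⁻) _)))
  ... | true  | false = surplus′ refl refl
        (trans (cong (_+ indeg E i) (m≤n⇒∣n-m∣≡n∸m (<⇒≤ in<out))) (m∸n+n≡m (<⇒≤ in<out)))
    where
    in<out : indeg E i < outdeg E i
    in<out = <ᵇ⇒< (indeg E i) _ (subst T (sym e⁺) _)
  ... | false | true  = deficit′ refl refl
        (trans (cong (_+ outdeg E i) (m≤n⇒∣m-n∣≡n∸m (<⇒≤ out<in))) (m∸n+n≡m (<⇒≤ out<in)))
    where
    out<in : outdeg E i < indeg E i
    out<in = <ᵇ⇒< (outdeg E i) _ (subst T (sym e⁻) _)
  ... | false | false = balanced′ refl refl (m≡n⇒∣m-n∣≡0 out≡in) out≡in
    where
    out≡in : outdeg E i ≡ indeg E i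
    out≡in = ≤-antisym (≮⇒≥ (λ in<out → subst T e⁺ (<⇒<ᵇ in<out)))
                       (≮⇒≥ (λ out<in → subst T e⁻ (<⇒<ᵇ out<in)))

  -- p_i and q_i of the construction (0 when not applicable); d = Σ p_i.
  excess shortfall : Fin n → ℕ
  excess    i = pick (surplus? i) (gap E i)
  shortfall i = pick (deficit? i) (gap E i)

  dval≡∑excess : dval E ≡ ∑ (allFin n) excess
  dval≡∑excess = sum-filter (λ i → indeg E i <? outdeg E i) (gap E) (allFin n)

  -- By the handshake identity the total deficit equals the total surplus d.
  ∑shortfall≡∑excess : ∑ (allFin n) shortfall ≡ ∑ (allFin n) excess
  ∑shortfall≡∑excess = +-cancelˡ-≡ (∑ (allFin n) (outdeg E)) _ _ (begin
    ∑ (allFin n) (outdeg E) + ∑ (allFin n) shortfall ≡⟨ ∑-+ (allFin n) _ _ ⟩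
    ∑ (allFin n) (λ i → outdeg E i + shortfall i)    ≡⟨ ∑-cong (allFin n) (λ i → balance-flow (balance i)) ⟩
    ∑ (allFin n) (λ i → indeg E i + excess i)        ≡⟨ sym (∑-+ (allFin n) _ _) ⟩
    ∑ (allFin n) (indeg E) + ∑ (allFin n) excess     ≡⟨ cong (_+ ∑ (allFin n) excess) (sym handshake) ⟩
    ∑ (allFin n) (outdeg E) + ∑ (allFin n) excess    ∎)
    where open ≡-Reasoning

  ∑2excess+shortfall≡3d : ∑ (allFin n) (λ i → 2 * excess i + shortfall i) ≡ 3 * dval E
  ∑2excess+shortfall≡3d = begin
    ∑ (allFin n) (λ i → 2 * excess i + shortfall i)
      ≡⟨ sym (∑-+ (allFin n) _ _) ⟩
    ∑ (allFin n) (λ i → 2 * excess i) + ∑ (allFin n) shortfall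
      ≡⟨ cong₂ _+_ (sym (∑-*ˡ (allFin n) 2 excess)) ∑shortfall≡∑excess ⟩
    2 * ∑ (allFin n) excess + ∑ (allFin n) excess
      ≡⟨ twice+once (∑ (allFin n) excess) ⟩
    3 * ∑ (allFin n) excess
      ≡⟨ cong (3 *_) (sym dval≡∑excess) ⟩
    3 * dval E ∎
    where
    open ≡-Reasoning
    twice+once : ∀ x → 2 * x + x ≡ 3 * x
    twice+once = solve-∀

  eulerian⇒dval≡0 : Eulerian E → dval E ≡ 0
  eulerian⇒dval≡0 eulerian = trans dval≡∑excess (∑-zero (allFin n) no-excess)
    where
    no-excess : ∀ i → pick (surplus? i) (gap E i) ≡ 0
    no-excess i with surplus? i in e⁺
    ... | true  = ⊥-elim (<-irrefl (eulerian i) (<ᵇ⇒< (indeg E i) _ (subst T (sym e⁺) _)))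
    ... | false = refl

  newArcsBy : Bool → Bool → (i : Fin n) → Fin (gap E i) → List (V' E × V' E)
  newArcsBy b⁺ b⁻ i j =
    if b⁺ then (s E , w E i j) ∷ (w E i j , vtx E i) ∷ []
    else if b⁻ then (w E i j , s E) ∷ (vtx E i , w E i j) ∷ []
    else []

  -- The arcs of the gadget through w_{i,j} that an acyclic arc set may use all together,
  -- given whether v_i reaches s (`reach`): at a surplus vertex s → w → v_i closes a cycle
  -- if v_i reaches s, at a deficit vertex v_i → w → s makes v_i reach s.
  gadget : Bool → Bool → Bool → (i : Fin n) → Fin (gap E i) → List (V' E × V' E)
  gadget true  _     true  i j = (w E i j , vtx E i) ∷ []
  gadget true  _     false i j = (s E , w E i j) ∷ (w E i j , vtx E i) ∷ []
  gadget false true  true  i j = (w E i j , s E) ∷ (vtx E i , w E i j) ∷ []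
  gadget false true  false i j = (vtx E i , w E i j) ∷ []
  gadget false false _     i j = []

  gadget⊆newArcs : ∀ b⁺ b⁻ reach {i j a} → a ∈ gadget b⁺ b⁻ reach i j → a ∈ newArcsBy b⁺ b⁻ i j
  gadget⊆newArcs true  _    true  (here refl) = there (here refl)
  gadget⊆newArcs true  _    false a∈          = a∈
  gadget⊆newArcs false true true  a∈          = a∈
  gadget⊆newArcs false true false (here refl) = there (here refl)

  length-gadget : ∀ b⁺ b⁻ reach i j → length (gadget b⁺ b⁻ reach i j) ≡ gadget-size b⁺ b⁻ reach
  length-gadget true  _     true  i j = refl
  length-gadget true  _     false i j = refl
  length-gadget false true  true  i j = refl
  length-gadget false true  false i j = refl
  length-gadget false false _     i j = refl

  gadgetsAt : (Fin n → Bool) → (i : Fin n) → List (V' E × V' E)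
  gadgetsAt reach i = concatMap (gadget (surplus? i) (deficit? i) (reach i) i) (allFin (gap E i))

  gadgets : (Fin n → Bool) → List (V' E × V' E)
  gadgets reach = concatMap (gadgetsAt reach) (allFin n)

  ∈-gadgets : ∀ reach {a} → a ∈ gadgets reach → ∃₂ λ i j → a ∈ gadget (surplus? i) (deficit? i) (reach i) i j
  ∈-gadgets reach a∈ with ∈-concatMap-∃ (gadgetsAt reach) {allFin n} a∈
  ... | i , _ , a∈i with ∈-concatMap-∃ (gadget (surplus? i) (deficit? i) (reach i) i) {allFin (gap E i)} a∈i
  ... | j , _ , a∈ij = i , j , a∈ij

  gadget⊆gadgets : ∀ reach {i j a} → a ∈ gadget (surplus? i) (deficit? i) (reach i) i j → a ∈ gadgets reach
  gadget⊆gadgets reach {i} {j} a∈ =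
    ∈-concatMap-intro (gadgetsAt reach) (∈-allFin i)
      (∈-concatMap-intro (gadget (surplus? i) (deficit? i) (reach i) i) (∈-allFin j) a∈)

  length-gadgets : ∀ reach →
    length (gadgets reach) ≡ ∑ (allFin n) (λ i → gap E i * gadget-size (surplus? i) (deficit? i) (reach i))
  length-gadgets reach = trans (length-concatMap (gadgetsAt reach) (allFin n)) (∑-cong (allFin n) per-vertex)
    where
    per-vertex : ∀ i → length (gadgetsAt reach i) ≡ gap E i * gadget-size (surplus? i) (deficit? i) (reach i)
    per-vertex i = begin
      length (gadgetsAt reach i)
        ≡⟨ length-concatMap _ (allFin (gap E i)) ⟩
      ∑ (allFin (gap E i)) (λ j → length (gadget (surplus? i) (deficit? i) (reach i) i j))
        ≡⟨ ∑-cong (allFin (gap E i)) (length-gadget (surplus? i) (deficit? i) (reach i) i) ⟩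
      ∑ (allFin (gap E i)) (λ _ → gadget-size (surplus? i) (deficit? i) (reach i))
        ≡⟨ ∑-const (gap E i) _ ⟩
      gap E i * gadget-size (surplus? i) (deficit? i) (reach i) ∎
      where open ≡-Reasoning

  length-gadgets-unreached : length (gadgets (λ _ → false)) ≡ 3 * dval E
  length-gadgets-unreached =
    trans (length-gadgets (λ _ → false))
          (trans (∑-cong (allFin n) (λ i → gadget-exact (balance i))) ∑2excess+shortfall≡3d)

  length-gadgets-bound : ∀ reach →
    ∑-marked reach (outdeg E) + length (gadgets reach) ≤ 3 * dval E + ∑-marked reach (indeg E)
  length-gadgets-bound reach = begin
    ∑-marked reach (outdeg E) + length (gadgets reach)
      ≡⟨ cong (∑-marked reach (outdeg E) +_) (length-gadgets reach) ⟩
    ∑-marked reach (outdeg E) + ∑ (allFin n) (λ i → gap E i * gadget-size (surplus? i) (deficit? i) (reach i))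
      ≡⟨ ∑-+ (allFin n) _ _ ⟩
    ∑ (allFin n) (λ i → pick (reach i) (outdeg E i) + gap E i * gadget-size (surplus? i) (deficit? i) (reach i))
      ≤⟨ ∑-mono (allFin n) (λ i → gadget-bound (balance i) (reach i)) ⟩
    ∑ (allFin n) (λ i → (2 * excess i + shortfall i) + pick (reach i) (indeg E i))
      ≡⟨ sym (∑-+ (allFin n) _ _) ⟩
    ∑ (allFin n) (λ i → 2 * excess i + shortfall i) + ∑-marked reach (indeg E)
      ≡⟨ cong (_+ ∑-marked reach (indeg E)) ∑2excess+shortfall≡3d ⟩
    3 * dval E + ∑-marked reach (indeg E) ∎
    where open ≤-Reasoning

  lift : Fin n × Fin n → V' E × V' E
  lift a = vtx E (proj₁ a) , vtx E (proj₂ a)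

  vtx-injective : ∀ {u v} → vtx E u ≡ vtx E v → u ≡ v
  vtx-injective refl = refl

  lift-injective : ∀ {a b} → lift a ≡ lift b → a ≡ b
  lift-injective {_ , _} {_ , _} refl = refl

  lift∈extended : ∀ {e} → e ∈ E → lift e ∈ arcs (extended E)
  lift∈extended e∈ = ∈-++⁺ˡ (∈-map⁺ lift e∈)

  newArc∈extended : ∀ {i j a} → a ∈ newArcs E i j → a ∈ arcs (extended E)
  newArc∈extended {i} {j} a∈ =
    ∈-++⁺ʳ (map lift E)
      (∈-concatMap-intro (λ i → concatMap (newArcs E i) (allFin (gap E i))) (∈-allFin i)
        (∈-concatMap-intro (newArcs E i) (∈-allFin j) a∈))

  extended-arc : ∀ {a} → a ∈ arcs (extended E) →
                 (∃ λ e → e ∈ E × a ≡ lift e) ⊎ (∃₂ λ i j → a ∈ newArcs E i j)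
  extended-arc a∈ with ∈-++⁻ (map lift E) a∈
  ... | inj₁ a∈lifted = inj₁ (∈-map⁻ lift a∈lifted)
  ... | inj₂ a∈new with ∈-concatMap-∃ (λ i → concatMap (newArcs E i) (allFin (gap E i))) {allFin n} a∈new
  ... | i , _ , a∈i with ∈-concatMap-∃ (newArcs E i) {allFin (gap E i)} a∈i
  ... | j , _ , a∈ij = inj₂ (i , j , a∈ij)

  -- The new vertex w_{i,j} an arc passes through, if any; it tells gadget arcs apart.
  WIndex : Set
  WIndex = Σ (Fin n) (λ i → Fin (gap E i))

  wIndex : V' E → Maybe WIndex
  wIndex (inj₂ (inj₂ p)) = just p
  wIndex _               = nothing

  arcIndex : V' E × V' E → Maybe WIndex
  arcIndex (x , y) = wIndex x <∣> wIndex y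

  gadget-index : ∀ b⁺ b⁻ reach {i j a} → a ∈ gadget b⁺ b⁻ reach i j → arcIndex a ≡ just (i , j)
  gadget-index true  _    true  (here refl)         = refl
  gadget-index true  _    false (here refl)         = refl
  gadget-index true  _    false (there (here refl)) = refl
  gadget-index false true true  (here refl)         = refl
  gadget-index false true true  (there (here refl)) = refl
  gadget-index false true false (here refl)         = refl

  gadget-unique : ∀ b⁺ b⁻ reach i j → Unique (gadget b⁺ b⁻ reach i j)
  gadget-unique true  _     true  i j = [] ∷ []
  gadget-unique true  _     false i j = ((λ ()) ∷ []) ∷ [] ∷ []
  gadget-unique false true  true  i j = ((λ ()) ∷ []) ∷ [] ∷ []
  gadget-unique false true  false i j = [] ∷ []
  gadget-unique false false _     i j = []

  gadgets-index : ∀ reach {a} → a ∈ gadgets reach → ∃ λ p → arcIndex a ≡ just p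
  gadgets-index reach a∈ with ∈-gadgets reach a∈
  ... | i , j , a∈ij = (i , j) , gadget-index (surplus? i) (deficit? i) (reach i) a∈ij

  gadgets-unique : ∀ reach → Unique (gadgets reach)
  gadgets-unique reach =
    concatMap-unique (gadgetsAt reach) (Maybe.map proj₁ ∘ arcIndex) just just-injective vertex-index
      (λ i → concatMap-unique (gadget (surplus? i) (deficit? i) (reach i) i) arcIndex (λ j → just (i , j))
               same-vertex (gadget-index (surplus? i) (deficit? i) (reach i))
               (gadget-unique (surplus? i) (deficit? i) (reach i) i) (Unique.allFin⁺ (gap E i)))
      (Unique.allFin⁺ n)
    where
    just-injective : ∀ {i i' : Fin n} → just i ≡ just i' → i ≡ i'
    just-injective refl = refl
    same-vertex : ∀ {i} {j j' : Fin (gap E i)} → _≡_ {A = Maybe WIndex} (just (i , j)) (just (i , j')) → j ≡ j'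
    same-vertex refl = refl
    vertex-index : ∀ {i a} → a ∈ gadgetsAt reach i → Maybe.map proj₁ (arcIndex a) ≡ just i
    vertex-index {i} a∈ with ∈-concatMap-∃ (gadget (surplus? i) (deficit? i) (reach i) i) {allFin (gap E i)} a∈
    ... | j , _ , a∈ij rewrite gadget-index (surplus? i) (deficit? i) (reach i) a∈ij = refl

  gadgets⊆extended : ∀ reach {a} → a ∈ gadgets reach → a ∈ arcs (extended E)
  gadgets⊆extended reach a∈ with ∈-gadgets reach a∈
  ... | i , j , a∈ij = newArc∈extended (gadget⊆newArcs (surplus? i) (deficit? i) (reach i) a∈ij)

  -- Layers of G' along which every gadget arc chosen with no vertex reaching s climbs:
  -- s, then the w's of surplus vertices, then the copy of G, then the w's of deficit vertices.
  layer : V' E → ℕ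
  layer (inj₁ _)              = 2
  layer (inj₂ (inj₁ _))       = 0
  layer (inj₂ (inj₂ (i , _))) = if surplus? i then 1 else 3

  gadget-climbs : ∀ {i j x y} → (x , y) ∈ gadget (surplus? i) (deficit? i) false i j → layer x < layer y
  gadget-climbs {i} {j} {x} {y} = climbs (surplus? i) (deficit? i) refl
    where
    climbs : ∀ b⁺ b⁻ → surplus? i ≡ b⁺ → (x , y) ∈ gadget b⁺ b⁻ false i j → layer x < layer y
    climbs true  _    e (here refl)         rewrite e = s≤s z≤n
    climbs true  _    e (there (here refl)) rewrite e = s≤s (s≤s z≤n)
    climbs false true e (here refl)         rewrite e = s≤s (s≤s (s≤s z≤n))

  lower-bound : ∀ A → IsAcyclicArcSet (G E) A →
                ∃ λ A' → IsAcyclicArcSet (extended E) A' × length A' ≡ 3 * dval E + length A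
  lower-bound A (A-unique , A⊆E , A-acyclic) = A' , (A'-unique , A'⊆extended , A'-acyclic) , A'-length
    where
    A' : List (V' E × V' E)
    A' = map lift A ++ gadgets (λ _ → false)

    A'-unique : Unique A'
    A'-unique = Unique.++⁺ (Unique.map⁺ lift-injective A-unique) (gadgets-unique (λ _ → false)) disjoint
      where
      disjoint : ∀ {a} → ¬ (a ∈ map lift A × a ∈ gadgets (λ _ → false))
      disjoint (a∈lifted , a∈gadgets) with ∈-map⁻ lift a∈lifted | gadgets-index (λ _ → false) a∈gadgets
      ... | _ , _ , refl | _ , ()

    A'⊆extended : ∀ {a} → a ∈ A' → a ∈ arcs (extended E)
    A'⊆extended a∈ with ∈-++⁻ (map lift A) a∈
    ... | inj₂ a∈gadgets = gadgets⊆extended (λ _ → false) a∈gadgets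
    ... | inj₁ a∈lifted with ∈-map⁻ lift a∈lifted
    ...   | _ , e∈A , refl = lift∈extended (A⊆E e∈A)

    flat : ∀ {x y} → (x , y) ∈ map lift A → layer x ≡ layer y
    flat a∈ with ∈-map⁻ lift a∈
    ... | _ , _ , refl = refl

    climbs : ∀ {x y} → (x , y) ∈ gadgets (λ _ → false) → layer x < layer y
    climbs a∈ with ∈-gadgets (λ _ → false) a∈
    ... | i , j , a∈ij = gadget-climbs a∈ij

    A'-acyclic : ∀ x → ¬ Path A' x x
    A'-acyclic x cycle with path-rank layer flat climbs cycle
    ... | inj₁ lt = <-irrefl refl lt
    ... | inj₂ lifted-cycle = no-lifted-cycle x lifted-cycle
      where
      no-lifted-cycle : ∀ x → ¬ Path (map lift A) x x
      no-lifted-cycle (inj₁ u) p = A-acyclic u (path-unmap (vtx E) vtx-injective p)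
      no-lifted-cycle (inj₂ _) (one m)    with ∈-map⁻ lift m
      ... | _ , _ , ()
      no-lifted-cycle (inj₂ _) (cons m _) with ∈-map⁻ lift m
      ... | _ , _ , ()

    A'-length : length A' ≡ 3 * dval E + length A
    A'-length = begin
      length A'                                            ≡⟨ length-++ (map lift A) ⟩
      length (map lift A) + length (gadgets (λ _ → false)) ≡⟨ cong₂ _+_ (length-map lift A) length-gadgets-unreached ⟩
      length A + 3 * dval E                                ≡⟨ +-comm (length A) _ ⟩
      3 * dval E + length A                                ∎
      where open ≡-Reasoning

  _≟V_ : DecidableEquality (V' E)
  _≟V_ = ⊎.≡-dec _≟_ (⊎.≡-dec Unit._≟_ (Σ.≡-dec _≟_ _≟_))

  open import Data.List.Membership.DecPropositional (Σ.≡-dec _≟V_ _≟V_) using (_∈?_)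

  -- Upper bound, for a fixed acyclic arc set A' of G'.  L is the set of v_i reaching s.
  module UpperBound (A' : List (V' E × V' E)) (A'-acyclic : ∀ v → ¬ Path A' v v) where

    reaches : Fin n → Bool
    reaches i = does (reachable? _≟V_ A' (vtx E i) (s E))

    reaches-s : ∀ {i} → reaches i ≡ true → Star (Arc A') (vtx E i) (s E)
    reaches-s {i} = does-true (reachable? _≟V_ A' (vtx E i) (s E))

    misses-s : ∀ {i} → reaches i ≡ false → ¬ Star (Arc A') (vtx E i) (s E)
    misses-s {i} = does-false (reachable? _≟V_ A' (vtx E i) (s E))

    no-entering-arc : ∀ {e} → lift e ∈ A' → ¬ Entering reaches e
    no-entering-arc e∈ (u-misses , v-reaches) = misses-s u-misses (e∈ ◅ reaches-s v-reaches)

    -- In a gadget, A' cannot use both arcs when they would close a cycle through s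
    -- (surplus, v_i ∈ L) or make v_i reach s (deficit, v_i ∉ L).
    surplus-gadget-cycle : ∀ {i j} → (s E , w E i j) ∈ A' → (w E i j , vtx E i) ∈ A' → ¬ reaches i ≡ true
    surplus-gadget-cycle s→w w→v v-reaches = A'-acyclic (s E) (cons s→w (arc◅star⇒path w→v (reaches-s v-reaches)))

    deficit-gadget-path : ∀ {i j} → (vtx E i , w E i j) ∈ A' → (w E i j , s E) ∈ A' → ¬ reaches i ≡ false
    deficit-gadget-path v→w w→s v-misses = misses-s v-misses (v→w ◅ w→s ◅ ε)

    -- Where A' may use at most one arc of a gadget (surplus at v_i ∈ L, deficit at v_i ∉ L),
    -- send the arc s → w, resp. w → s, onto its partner; other arcs are left alone.  Then
    -- A' lands in a list determined by L alone, injectively.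
    redirect : V' E × V' E → V' E × V' E
    redirect (inj₂ (inj₁ _) , inj₂ (inj₂ (i , j))) = if reaches i then (w E i j , vtx E i) else (s E , w E i j)
    redirect (inj₂ (inj₂ (i , j)) , inj₂ (inj₁ _)) = if reaches i then (w E i j , s E) else (vtx E i , w E i j)
    redirect a = a

    data Redirection : V' E × V' E → V' E × V' E → Set where
      unchanged : ∀ {a} → Redirection a a
      surplus-redirected : ∀ {i j} → reaches i ≡ true → Redirection (s E , w E i j) (w E i j , vtx E i)
      deficit-redirected : ∀ {i j} → reaches i ≡ false → Redirection (w E i j , s E) (vtx E i , w E i j)

    redirection : ∀ a → Redirection a (redirect a)
    redirection (inj₁ _ , _)                        = unchanged
    redirection (inj₂ (inj₁ _) , inj₁ _)            = unchanged
    redirection (inj₂ (inj₁ _) , inj₂ (inj₁ _))     = unchanged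
    redirection (inj₂ (inj₁ _) , inj₂ (inj₂ (i , j))) with reaches i in reach
    ... | true  = surplus-redirected reach
    ... | false = unchanged
    redirection (inj₂ (inj₂ _) , inj₁ _)            = unchanged
    redirection (inj₂ (inj₂ (i , j)) , inj₂ (inj₁ _)) with reaches i in reach
    ... | true  = unchanged
    ... | false = deficit-redirected reach
    redirection (inj₂ (inj₂ _) , inj₂ (inj₂ _))     = unchanged

    redirect-injective : ∀ {a b} → a ∈ A' → b ∈ A' → redirect a ≡ redirect b → a ≡ b
    redirect-injective {a} {b} a∈ b∈ eq with redirect a | redirection a | redirect b | redirection b
    ... | _ | unchanged | _ | unchanged = eq
    ... | _ | unchanged | _ | surplus-redirected r =
      ⊥-elim (surplus-gadget-cycle b∈ (subst (_∈ A') eq a∈) r)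
    ... | _ | unchanged | _ | deficit-redirected r =
      ⊥-elim (deficit-gadget-path (subst (_∈ A') eq a∈) b∈ r)
    ... | _ | surplus-redirected r | _ | unchanged =
      ⊥-elim (surplus-gadget-cycle a∈ (subst (_∈ A') (sym eq) b∈) r)
    ... | _ | deficit-redirected r | _ | unchanged =
      ⊥-elim (deficit-gadget-path (subst (_∈ A') (sym eq) b∈) a∈ r)
    ... | _ | surplus-redirected _ | _ | surplus-redirected _ = same-w eq
      where
      same-w : ∀ {i i' j j'} → _≡_ {A = V' E × V' E} (w E i j , vtx E i) (w E i' j' , vtx E i') →
               _≡_ {A = V' E × V' E} (s E , w E i j) (s E , w E i' j')
      same-w refl = refl
    ... | _ | deficit-redirected _ | _ | deficit-redirected _ = same-w eq
      where
      same-w : ∀ {i i' j j'} → _≡_ {A = V' E × V' E} (vtx E i , w E i j) (vtx E i' , w E i' j') →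
               _≡_ {A = V' E × V' E} (w E i j , s E) (w E i' j' , s E)
      same-w refl = refl
    ... | _ | surplus-redirected _ | _ | deficit-redirected _ with () ← eq
    ... | _ | deficit-redirected _ | _ | surplus-redirected _ with () ← eq

    inside leavingArcs enteringArcs : List (Fin n × Fin n)
    inside       = filter (λ e → reaches (proj₁ e) Bool.≟ reaches (proj₂ e)) (filter (λ e → lift e ∈? A') E)
    leavingArcs  = filter (leaving? reaches) E
    enteringArcs = filter (entering? reaches) E

    -- A' injects, via redirect, into these arcs and the gadget arcs allowed by L.
    target : List (V' E × V' E)
    target = map lift (inside ++ leavingArcs) ++ gadgets reaches

    lifted∈target : ∀ {e} → e ∈ E → lift e ∈ A' → lift e ∈ target
    lifted∈target {e} e∈ lift∈ = ∈-++⁺ˡ (∈-map⁺ lift (classify (reaches (proj₁ e)) (reaches (proj₂ e)) refl refl))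
      where
      classify : ∀ b c → reaches (proj₁ e) ≡ b → reaches (proj₂ e) ≡ c → e ∈ inside ++ leavingArcs
      classify true  false eu ev = ∈-++⁺ʳ inside (∈-filter⁺ (leaving? reaches) e∈ (eu , ev))
      classify false true  eu ev = ⊥-elim (no-entering-arc lift∈ (eu , ev))
      classify true  true  eu ev = ∈-++⁺ˡ (∈-filter⁺ _ (∈-filter⁺ _ e∈ lift∈) (trans eu (sym ev)))
      classify false false eu ev = ∈-++⁺ˡ (∈-filter⁺ _ (∈-filter⁺ _ e∈ lift∈) (trans eu (sym ev)))

    redirect-gadget : ∀ b⁺ b⁻ {i j a} → a ∈ newArcsBy b⁺ b⁻ i j → redirect a ∈ gadget b⁺ b⁻ (reaches i) i j
    redirect-gadget true  _ {i} (here refl) with reaches i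
    ... | true  = here refl
    ... | false = here refl
    redirect-gadget true  _ {i} (there (here refl)) with reaches i
    ... | true  = here refl
    ... | false = there (here refl)
    redirect-gadget false true {i} (here refl) with reaches i
    ... | true  = here refl
    ... | false = here refl
    redirect-gadget false true {i} (there (here refl)) with reaches i
    ... | true  = there (here refl)
    ... | false = here refl

    redirect∈target : ∀ {a} → a ∈ arcs (extended E) → a ∈ A' → redirect a ∈ target
    redirect∈target a∈G' a∈ with extended-arc a∈G'
    ... | inj₁ (e , e∈ , refl) = lifted∈target e∈ a∈
    ... | inj₂ (i , j , a∈new) =
      ∈-++⁺ʳ (map lift (inside ++ leavingArcs))
        (gadget⊆gadgets reaches (redirect-gadget (surplus? i) (deficit? i) a∈new))

    -- The acyclic arc set of G that pays for A': the arcs of A' inside L or outside L,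
    -- together with all arcs of G entering L.
    B : List (Fin n × Fin n)
    B = inside ++ enteringArcs

    B-arc : ∀ {e} → e ∈ B → (reaches (proj₁ e) ≡ reaches (proj₂ e) × lift e ∈ A') ⊎ Entering reaches e
    B-arc e∈ with ∈-++⁻ inside e∈
    ... | inj₁ e∈inside with ∈-filter⁻ _ {xs = filter _ E} e∈inside
    ...   | e∈used , same-side = inj₁ (same-side , proj₂ (∈-filter⁻ _ {xs = E} e∈used))
    B-arc e∈ | inj₂ e∈entering = inj₂ (proj₂ (∈-filter⁻ (entering? reaches) {xs = E} e∈entering))

    B⊆E : ∀ {e} → e ∈ B → e ∈ E
    B⊆E e∈ with ∈-++⁻ inside e∈
    ... | inj₁ e∈inside   = proj₁ (∈-filter⁻ _ {xs = E} (proj₁ (∈-filter⁻ _ {xs = filter _ E} e∈inside)))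
    ... | inj₂ e∈entering = proj₁ (∈-filter⁻ (entering? reaches) {xs = E} e∈entering)

    B-unique : Unique E → Unique B
    B-unique E-unique = Unique.++⁺ (Unique.filter⁺ _ (Unique.filter⁺ _ E-unique))
                                   (Unique.filter⁺ (entering? reaches) E-unique) disjoint
      where
      disjoint : ∀ {e} → ¬ (e ∈ inside × e ∈ enteringArcs)
      disjoint (e∈inside , e∈entering)
        with proj₂ (∈-filter⁻ _ {xs = filter _ E} e∈inside)
           | proj₂ (∈-filter⁻ (entering? reaches) {xs = E} e∈entering)
      ... | same-side | u-misses , v-reaches = false≢true (trans (sym u-misses) (trans same-side v-reaches))

    B-stays-in-L : ∀ {u v} → Path B u v → reaches u ≡ true → reaches v ≡ true
    B-stays-in-L (one m)    u∈L with B-arc m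
    ... | inj₁ (same-side , _) = trans (sym same-side) u∈L
    ... | inj₂ (_ , v∈L)       = v∈L
    B-stays-in-L (cons m p) u∈L with B-arc m
    ... | inj₁ (same-side , _) = B-stays-in-L p (trans (sym same-side) u∈L)
    ... | inj₂ (_ , x∈L)       = B-stays-in-L p x∈L

    B-path-in-A' : ∀ {u v} → reaches u ≡ reaches v → Path B u v → Path A' (vtx E u) (vtx E v)
    B-path-in-A' same (one m) with B-arc m
    ... | inj₁ (_ , lifted)       = one lifted
    ... | inj₂ (u∉L , v∈L)        = ⊥-elim (false≢true (trans (sym u∉L) (trans same v∈L)))
    B-path-in-A' same (cons m p) with B-arc m
    ... | inj₁ (same₁ , lifted)   = cons lifted (B-path-in-A' (trans (sym same₁) same) p)
    ... | inj₂ (u∉L , x∈L)        = ⊥-elim (false≢true (trans (sym u∉L) (trans same (B-stays-in-L p x∈L))))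

    B-acyclic : ∀ v → ¬ Path B v v
    B-acyclic v cycle = A'-acyclic (vtx E v) (B-path-in-A' refl cycle)

    A'-length : Unique A' → (∀ {a} → a ∈ A' → a ∈ arcs (extended E)) → length A' ≤ 3 * dval E + length B
    A'-length A'-unique A'⊆G' = begin
      length A'
        ≤⟨ injection-length-≤ redirect A' target A'-unique redirect-injective (λ a∈ → redirect∈target (A'⊆G' a∈) a∈) ⟩
      length target
        ≡⟨ trans (length-++ (map lift (inside ++ leavingArcs)))
                 (cong (_+ length (gadgets reaches)) (trans (length-map lift (inside ++ leavingArcs)) (length-++ inside))) ⟩
      (length inside + length leavingArcs) + length (gadgets reaches)
        ≤⟨ rebalance (length inside) _ _ _ _ _ _ (cut-identity reaches) (length-gadgets-bound reaches) ⟩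
      3 * dval E + (length inside + length enteringArcs)
        ≡⟨ cong (3 * dval E +_) (sym (length-++ inside)) ⟩
      3 * dval E + length B ∎
      where open ≤-Reasoning

  upper-bound : Unique E → ∀ A' → IsAcyclicArcSet (extended E) A' →
                ∃ λ B → IsAcyclicArcSet (G E) B × length A' ≤ 3 * dval E + length B
  upper-bound E-unique A' (A'-unique , A'⊆G' , A'-acyclic) =
    B , (B-unique E-unique , B⊆E , B-acyclic) , A'-length A'-unique A'⊆G'
    where open UpperBound A' A'-acyclic

lemma4 : (n : ℕ) (E : List (Fin n × Fin n)) →
    Simple (G E) → Connected (G E) →
    (r : ℕ) → IsMaxAcyclic (G E) r →
    IsMaxAcyclic (G' E) (3 * dval E + r)
lemma4 n E (E-unique , _) _ r max-r@((A , A-acyclic , |A|≡r) , maximal) with eulerian? E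
... | yes eulerian = subst (IsMaxAcyclic (G E)) (cong (λ d → 3 * d + r) (sym (eulerian⇒dval≡0 E eulerian))) max-r
... | no _ = maximum-of-extension (lower-bound E A A-acyclic)
  where
  at-most : ∀ A'' → IsAcyclicArcSet (extended E) A'' → length A'' ≤ 3 * dval E + r
  at-most A'' A''-acyclic = bounded (upper-bound E E-unique A'' A''-acyclic)
    where
    bounded : (∃ λ B → IsAcyclicArcSet (G E) B × length A'' ≤ 3 * dval E + length B) → length A'' ≤ 3 * dval E + r
    bounded (B , B-acyclic , |A''|≤3d+|B|) = ≤-trans |A''|≤3d+|B| (+-monoʳ-≤ (3 * dval E) (maximal B B-acyclic))

  maximum-of-extension : (∃ λ A' → IsAcyclicArcSet (extended E) A' × length A' ≡ 3 * dval E + length A) →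
                         IsMaxAcyclic (extended E) (3 * dval E + r)
  maximum-of-extension (A' , A'-acyclic , |A'|≡3d+|A|) =
    (A' , A'-acyclic , trans |A'|≡3d+|A| (cong (3 * dval E +_) |A|≡r)) , at-most
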